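{- Let $n, r \geq 1$ and $\ell \in \mathbb{Z} \setminus \{0,1\}$. If there exists an index $d \in \{1,\ldots,r\}$ such that \[ r!\, (\ell-1)^{r-d} \left( (\ell-1)^{n+d} - \ell^{n+d} \right) \not\equiv 0 \pmod{n+d}, \] then $\mathcal{S}_{(r,n)}(\ell) \notin \mathbb{Z}$.
   Context: For integers $n, r \geq 0$, $\mathcal{S}_{(r,n)}(x) = \sum_{k=0}^{n} \binom{n}{k} (-1)^k x^{n-k} \binom{r+k}{r}^{ -1} \in \mathbb{Q}[x]$. -}

module Defs where

open import Data.Nat as ℕ using (ℕ; zero; suc)
open import Data.Nat.Combinatorics using (_C_)
open import Data.Integer as ℤ using (ℤ; +_)
open import Data.Rational as ℚ using (ℚ; _/_; 0ℚ)
open import Data.List using (List; foldr; map; upTo)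

fromℤ : ℤ → ℚ
fromℤ z = z / 1

-- reciprocal of a natural number as a rational (only ever applied to
-- binomial coefficients C(r+k, r) ≥ 1, so the zero case is never used)
inv : ℕ → ℚ
inv zero = 0ℚ
inv (suc m) = + 1 / suc m

pow : ℚ → ℕ → ℚ
pow x zero = ℚ.1ℚ
pow x (suc m) = x ℚ.* pow x m

sgn : ℕ → ℚ
sgn zero = ℚ.1ℚ
sgn (suc k) = ℚ.- sgn k

-- S_(r,n)(x) = Σ_{k=0}^{n} C(n,k) (-1)^k x^(n-k) / C(r+k, r)
S : ℕ → ℕ → ℚ → ℚ
S r n x = foldr ℚ._+_ 0ℚ (map term (upTo (suc n)))
  where
  term : ℕ → ℚ
  term k = ((fromℤ (+ (n C k)) ℚ.* sgn k) ℚ.* pow x (n ℕ.∸ k)) ℚ.* inv ((r ℕ.+ k) C r)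

-- Absorption and Pascal's rule for binomial coefficients give two recurrences for
--   S s m = S_(s,m)(x):
--     (m+1) S (s+1) m = (s+1) (x^(m+1) - S s (m+1)),
--     s S (s+1) m     = (s+1) (S s (m+1) - (x-1) S s m),
-- together with S 0 m = (x-1)^m.  If x and S r n are integers, induction along these
-- recurrences shows that (r'+1)(r'+2)...(r'+k+j) (x-1)^k S r' (n+j) is an integer
-- whenever r' + k + j = r.  Taking r' = 1, j = d-1, k = r-d gives an integer
-- w = r! (x-1)^(r-d) S 1 (n+d-1), and the first recurrence at s = 0 gives
-- (n+d) S 1 (n+d-1) = x^(n+d) - (x-1)^(n+d), so the obstruction is -(n+d) w.

module Submission where

open import Defs
open import Function using (id)
open import Data.Nat as ℕ using (ℕ; zero; suc; _∸_; _<_; _≤_; s≤s; z≤n; _!)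
import Data.Nat.Properties as ℕP
open import Data.Nat.Combinatorics
  using (_C_; nCn≡1; nC1≡n; nCk≡nC[n∸k]; k>n⇒nCk≡0; nCk+nC[k+1]≡[n+1]C[k+1])
import Data.Nat.Divisibility as ℕD
open import Data.Nat.Solver using (module +-*-Solver)
open import Data.Integer as ℤ using (ℤ; +_)
import Data.Integer.Properties as ℤP
open import Data.Integer.Divisibility using (_∣_)
open import Data.Rational as ℚ using (ℚ; _+_; _-_; _*_; -_; 0ℚ; 1ℚ)
import Data.Rational.Properties as ℚP
open import Data.Rational.Unnormalised using (mkℚᵘ; *≡*) renaming (_≃_ to _≃ᵘ_)
import Data.Rational.Unnormalised.Properties as ℚᵘP
import Data.Rational.Solver
open import Data.List using (foldr; map; applyUpTo)
open import Data.Product using (∃; _,_; _×_; proj₁; proj₂)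
open import Relation.Nullary using (¬_; yes; no)
open import Relation.Binary.PropositionalEquality
open ≡-Reasoning

[1+k]*[1+n]C[1+k]≡[1+n]*nCk : ∀ n k → suc k ℕ.* (suc n C suc k) ≡ suc n ℕ.* (n C k)
[1+k]*[1+n]C[1+k]≡[1+n]*nCk zero zero = refl
[1+k]*[1+n]C[1+k]≡[1+n]*nCk zero (suc k) = begin
  suc (suc k) ℕ.* (1 C suc (suc k)) ≡⟨ cong (suc (suc k) ℕ.*_) (k>n⇒nCk≡0 {1} {suc (suc k)} (s≤s (s≤s z≤n))) ⟩
  suc (suc k) ℕ.* 0                 ≡⟨ ℕP.*-zeroʳ (suc (suc k)) ⟩
  0                                 ≡⟨ cong (1 ℕ.*_) (k>n⇒nCk≡0 {0} {suc k} (s≤s z≤n)) ⟨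
  1 ℕ.* (0 C suc k)                 ∎
[1+k]*[1+n]C[1+k]≡[1+n]*nCk (suc n) zero =
  trans (ℕP.+-identityʳ _) (trans (nC1≡n (suc (suc n))) (sym (ℕP.*-identityʳ _)))
[1+k]*[1+n]C[1+k]≡[1+n]*nCk (suc n) (suc k) = begin
  suc (suc k) ℕ.* (suc (suc n) C suc (suc k))  ≡⟨ cong (suc (suc k) ℕ.*_) (nCk+nC[k+1]≡[n+1]C[k+1] (suc n) (suc k)) ⟨
  suc (suc k) ℕ.* (A ℕ.+ B)                    ≡⟨ solve 3 (λ k A B → (con 2 :+ k) :* (A :+ B) := ((con 1 :+ k) :* A :+ A) :+ (con 2 :+ k) :* B) refl k A B ⟩
  (suc k ℕ.* A ℕ.+ A) ℕ.+ suc (suc k) ℕ.* B    ≡⟨ cong₂ (λ u v → (u ℕ.+ A) ℕ.+ v) ([1+k]*[1+n]C[1+k]≡[1+n]*nCk n k) ([1+k]*[1+n]C[1+k]≡[1+n]*nCk n (suc k)) ⟩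
  (suc n ℕ.* (n C k) ℕ.+ A) ℕ.+ suc n ℕ.* (n C suc k) ≡⟨ solve 4 (λ n c e A → (n :* c :+ A) :+ n :* e := n :* (c :+ e) :+ A) refl (suc n) (n C k) (n C suc k) A ⟩
  suc n ℕ.* (n C k ℕ.+ n C suc k) ℕ.+ A        ≡⟨ cong (λ u → suc n ℕ.* u ℕ.+ A) (nCk+nC[k+1]≡[n+1]C[k+1] n k) ⟩
  suc n ℕ.* A ℕ.+ A                            ≡⟨ ℕP.+-comm (suc n ℕ.* A) A ⟩
  suc (suc n) ℕ.* A                            ∎
  where
  open +-*-Solver
  A = suc n C suc k
  B = suc n C suc (suc k)

[m+n]Cm≡[m+n]Cn : ∀ m n → (m ℕ.+ n) C m ≡ (m ℕ.+ n) C n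
[m+n]Cm≡[m+n]Cn m n = trans (nCk≡nC[n∸k] (ℕP.m≤m+n m n)) (cong ((m ℕ.+ n) C_) (ℕP.m+n∸m≡n m n))

[m+n]Cm>0 : ∀ m n → 0 < (m ℕ.+ n) C m
[m+n]Cm>0 zero n = s≤s z≤n
[m+n]Cm>0 (suc m) zero = subst (λ u → 0 < u C suc m) (sym (cong suc (ℕP.+-identityʳ m)))
  (subst (0 <_) (sym (nCn≡1 (suc m))) (s≤s z≤n))
[m+n]Cm>0 (suc m) (suc n) = subst (0 <_) (nCk+nC[k+1]≡[n+1]C[k+1] (m ℕ.+ suc n) m)
  (ℕP.≤-trans ([m+n]Cm>0 m (suc n)) (ℕP.m≤m+n _ _))

[1+s]*[1+s+j]C[1+s]≡[1+j]*[1+s+j]Cs : ∀ s j → suc s ℕ.* (suc (s ℕ.+ j) C suc s) ≡ suc j ℕ.* (suc (s ℕ.+ j) C s)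
[1+s]*[1+s+j]C[1+s]≡[1+j]*[1+s+j]Cs s j = begin
  suc s ℕ.* (suc (s ℕ.+ j) C suc s)  ≡⟨ [1+k]*[1+n]C[1+k]≡[1+n]*nCk (s ℕ.+ j) s ⟩
  suc (s ℕ.+ j) ℕ.* ((s ℕ.+ j) C s)  ≡⟨ cong (suc (s ℕ.+ j) ℕ.*_) ([m+n]Cm≡[m+n]Cn s j) ⟩
  suc (s ℕ.+ j) ℕ.* ((s ℕ.+ j) C j)  ≡⟨ [1+k]*[1+n]C[1+k]≡[1+n]*nCk (s ℕ.+ j) j ⟨
  suc j ℕ.* (suc (s ℕ.+ j) C suc j)  ≡⟨ cong (λ u → suc j ℕ.* (u C suc j)) (ℕP.+-suc s j) ⟨
  suc j ℕ.* ((s ℕ.+ suc j) C suc j)  ≡⟨ cong (suc j ℕ.*_) ([m+n]Cm≡[m+n]Cn s (suc j)) ⟨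
  suc j ℕ.* ((s ℕ.+ suc j) C s)      ≡⟨ cong (λ u → suc j ℕ.* (u C s)) (ℕP.+-suc s j) ⟩
  suc j ℕ.* (suc (s ℕ.+ j) C s)      ∎

open Data.Rational.Solver.+-*-Solver

-- z / suc m is definitionally the normalisation fromℚᵘ (mkℚᵘ z m).
toℚᵘ-/ : ∀ z m → ℚ.toℚᵘ (z ℚ./ suc m) ≃ᵘ mkℚᵘ z m
toℚᵘ-/ z m = ℚP.toℚᵘ-fromℚᵘ (mkℚᵘ z m)

≃ᵘ⇒≡fromℤ : ∀ {p} z → ℚ.toℚᵘ p ≃ᵘ mkℚᵘ z 0 → p ≡ fromℤ z
≃ᵘ⇒≡fromℤ z p≃z = ℚP.toℚᵘ-injective (ℚᵘP.≃-trans p≃z (ℚᵘP.≃-sym (toℚᵘ-/ z 0)))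

fromℤ-+ : ∀ a b → fromℤ (a ℤ.+ b) ≡ fromℤ a + fromℤ b
fromℤ-+ a b = sym (≃ᵘ⇒≡fromℤ (a ℤ.+ b) (ℚᵘP.≃-trans (ℚP.toℚᵘ-homo-+ (fromℤ a) (fromℤ b))
  (ℚᵘP.≃-trans (ℚᵘP.+-cong (toℚᵘ-/ a 0) (toℚᵘ-/ b 0)) (*≡* (begin
    (a ℤ.* ℤ.1ℤ ℤ.+ b ℤ.* ℤ.1ℤ) ℤ.* ℤ.1ℤ ≡⟨ ℤP.*-identityʳ _ ⟩
    a ℤ.* ℤ.1ℤ ℤ.+ b ℤ.* ℤ.1ℤ            ≡⟨ cong₂ ℤ._+_ (ℤP.*-identityʳ a) (ℤP.*-identityʳ b) ⟩
    a ℤ.+ b                             ≡⟨ ℤP.*-identityʳ _ ⟨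
    (a ℤ.+ b) ℤ.* ℤ.1ℤ                  ∎)))))

fromℤ-* : ∀ a b → fromℤ (a ℤ.* b) ≡ fromℤ a * fromℤ b
fromℤ-* a b = sym (≃ᵘ⇒≡fromℤ (a ℤ.* b) (ℚᵘP.≃-trans (ℚP.toℚᵘ-homo-* (fromℤ a) (fromℤ b))
  (ℚᵘP.≃-trans (ℚᵘP.*-cong (toℚᵘ-/ a 0) (toℚᵘ-/ b 0)) (*≡* refl))))

fromℤ-neg : ∀ a → fromℤ (ℤ.- a) ≡ - fromℤ a
fromℤ-neg a = sym (≃ᵘ⇒≡fromℤ (ℤ.- a) (ℚᵘP.≃-trans (ℚP.toℚᵘ-homo‿- (fromℤ a)) (ℚᵘP.-‿cong (toℚᵘ-/ a 0))))

fromℤ-- : ∀ a b → fromℤ (a ℤ.- b) ≡ fromℤ a - fromℤ b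
fromℤ-- a b = trans (fromℤ-+ a (ℤ.- b)) (cong (_+_ (fromℤ a)) (fromℤ-neg b))

fromℤ-pow : ∀ z k → fromℤ (z ℤ.^ k) ≡ pow (fromℤ z) k
fromℤ-pow z zero = refl
fromℤ-pow z (suc k) = trans (fromℤ-* z (z ℤ.^ k)) (cong (fromℤ z *_) (fromℤ-pow z k))

fromℤ-injective : ∀ a b → fromℤ a ≡ fromℤ b → a ≡ b
fromℤ-injective a b a≡b
  with ℚᵘP.≃-trans (ℚᵘP.≃-sym (toℚᵘ-/ a 0)) (ℚᵘP.≃-trans (ℚP.toℚᵘ-cong a≡b) (toℚᵘ-/ b 0))
... | *≡* eq = trans (sym (ℤP.*-identityʳ a)) (trans eq (ℤP.*-identityʳ b))

fromℕ : ℕ → ℚ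
fromℕ n = fromℤ (+ n)

fromℕ-+ : ∀ a b → fromℕ (a ℕ.+ b) ≡ fromℕ a + fromℕ b
fromℕ-+ a b = trans (cong fromℤ (ℤP.pos-+ a b)) (fromℤ-+ (+ a) (+ b))

fromℕ-* : ∀ a b → fromℕ (a ℕ.* b) ≡ fromℕ a * fromℕ b
fromℕ-* a b = trans (cong fromℤ (ℤP.pos-* a b)) (fromℤ-* (+ a) (+ b))

inv-inverseˡ : ∀ m → inv (suc m) * fromℕ (suc m) ≡ 1ℚ
inv-inverseˡ m = ℚP.toℚᵘ-injective (ℚᵘP.≃-trans (ℚP.toℚᵘ-homo-* (inv (suc m)) (fromℕ (suc m)))
  (ℚᵘP.≃-trans (ℚᵘP.*-cong (toℚᵘ-/ (+ 1) m) (toℚᵘ-/ (+ suc m) 0)) (*≡* (begin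
    (+ 1 ℤ.* + suc m) ℤ.* ℤ.1ℤ ≡⟨ ℤP.*-identityʳ _ ⟩
    + 1 ℤ.* + suc m           ≡⟨ ℤP.*-identityˡ _ ⟩
    + suc m                   ≡⟨ cong +_ (ℕP.*-identityʳ (suc m)) ⟨
    + (suc m ℕ.* 1)           ≡⟨ ℤP.*-identityˡ _ ⟨
    ℤ.1ℤ ℤ.* + (suc m ℕ.* 1)  ∎))))

inv-cross : ∀ a b X Y → 0 < X → 0 < Y → a * fromℕ Y ≡ b * fromℕ X → a * inv X ≡ b * inv Y
inv-cross a b X@(suc x) Y@(suc y) _ _ aY≡bX = begin
  a * inv X                                 ≡⟨ ℚP.*-identityʳ _ ⟨
  (a * inv X) * 1ℚ                          ≡⟨ cong ((a * inv X) *_) (inv-inverseˡ y) ⟨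
  (a * inv X) * (inv Y * fromℕ Y)           ≡⟨ solve 4 (λ a i j c → (a :* i) :* (j :* c) := ((a :* c) :* i) :* j) refl a (inv X) (inv Y) (fromℕ Y) ⟩
  ((a * fromℕ Y) * inv X) * inv Y           ≡⟨ cong (λ u → (u * inv X) * inv Y) aY≡bX ⟩
  ((b * fromℕ X) * inv X) * inv Y           ≡⟨ solve 4 (λ b i j c → ((b :* c) :* i) :* j := (b :* j) :* (i :* c)) refl b (inv X) (inv Y) (fromℕ X) ⟩
  (b * inv Y) * (inv X * fromℕ X)           ≡⟨ cong ((b * inv Y) *_) (inv-inverseˡ x) ⟩
  (b * inv Y) * 1ℚ                          ≡⟨ ℚP.*-identityʳ _ ⟩
  b * inv Y                                 ∎

invBinom : ℕ → ℕ → ℚ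
invBinom s k = inv ((s ℕ.+ k) C s)

invBinom-absorb : ∀ s k → fromℕ (suc k) * invBinom (suc s) k ≡ fromℕ (suc s) * invBinom s (suc k)
invBinom-absorb s k =
  inv-cross (fromℕ (suc k)) (fromℕ (suc s)) ((suc s ℕ.+ k) C suc s) ((s ℕ.+ suc k) C s) ([m+n]Cm>0 (suc s) k) ([m+n]Cm>0 s (suc k)) (begin
    fromℕ (suc k) * fromℕ ((s ℕ.+ suc k) C s)   ≡⟨ fromℕ-* (suc k) ((s ℕ.+ suc k) C s) ⟨
    fromℕ (suc k ℕ.* ((s ℕ.+ suc k) C s))       ≡⟨ cong (λ u → fromℕ (suc k ℕ.* (u C s))) (ℕP.+-suc s k) ⟩
    fromℕ (suc k ℕ.* (suc (s ℕ.+ k) C s))       ≡⟨ cong fromℕ ([1+s]*[1+s+j]C[1+s]≡[1+j]*[1+s+j]Cs s k) ⟨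
    fromℕ (suc s ℕ.* (suc (s ℕ.+ k) C suc s))   ≡⟨ fromℕ-* (suc s) (suc (s ℕ.+ k) C suc s) ⟩
    fromℕ (suc s) * fromℕ (suc (s ℕ.+ k) C suc s) ∎)

invBinom-pascal : ∀ s j → fromℕ (suc s) * invBinom s j - fromℕ (suc s) * invBinom s (suc j) ≡ fromℕ s * invBinom (suc s) j
invBinom-pascal s j = begin
  fromℕ (suc s) * invBinom s j - fromℕ (suc s) * invBinom s (suc j)
    ≡⟨ cong₂ _-_ [1+s]/X≡[1+s+j]/Z [1+s]/Y≡[1+j]/Z ⟩
  fromℕ (suc (s ℕ.+ j)) * invBinom (suc s) j - fromℕ (suc j) * invBinom (suc s) j
    ≡⟨ cong (λ u → fromℕ u * invBinom (suc s) j - fromℕ (suc j) * invBinom (suc s) j) (ℕP.+-suc s j) ⟨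
  fromℕ (s ℕ.+ suc j) * invBinom (suc s) j - fromℕ (suc j) * invBinom (suc s) j
    ≡⟨ cong (λ u → u * invBinom (suc s) j - fromℕ (suc j) * invBinom (suc s) j) (fromℕ-+ s (suc j)) ⟩
  (fromℕ s + fromℕ (suc j)) * invBinom (suc s) j - fromℕ (suc j) * invBinom (suc s) j
    ≡⟨ solve 3 (λ a b z → (a :+ b) :* z :- b :* z := a :* z) refl (fromℕ s) (fromℕ (suc j)) (invBinom (suc s) j) ⟩
  fromℕ s * invBinom (suc s) j ∎
  where
  Z = suc (s ℕ.+ j) C suc s
  [1+s]/X≡[1+s+j]/Z : fromℕ (suc s) * invBinom s j ≡ fromℕ (suc (s ℕ.+ j)) * invBinom (suc s) j
  [1+s]/X≡[1+s+j]/Z = inv-cross (fromℕ (suc s)) (fromℕ (suc (s ℕ.+ j))) ((s ℕ.+ j) C s) Z ([m+n]Cm>0 s j) ([m+n]Cm>0 (suc s) j)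
    (trans (sym (fromℕ-* (suc s) Z)) (trans (cong fromℕ ([1+k]*[1+n]C[1+k]≡[1+n]*nCk (s ℕ.+ j) s)) (fromℕ-* (suc (s ℕ.+ j)) ((s ℕ.+ j) C s))))
  [1+s]/Y≡[1+j]/Z : fromℕ (suc s) * invBinom s (suc j) ≡ fromℕ (suc j) * invBinom (suc s) j
  [1+s]/Y≡[1+j]/Z = sym (invBinom-absorb s j)

∑< : ℕ → (ℕ → ℚ) → ℚ
∑< zero    f = 0ℚ
∑< (suc n) f = f 0 + ∑< n (λ k → f (suc k))

syntax ∑< n (λ k → e) = ∑[ k < n ] e

foldr-map-applyUpTo : ∀ (g : ℕ → ℚ) f n → foldr _+_ 0ℚ (map g (applyUpTo f n)) ≡ ∑[ k < n ] g (f k)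
foldr-map-applyUpTo g f zero    = refl
foldr-map-applyUpTo g f (suc n) = cong (_+_ (g (f 0))) (foldr-map-applyUpTo g (λ k → f (suc k)) n)

∑-cong : ∀ {f g : ℕ → ℚ} n → (∀ k → f k ≡ g k) → ∑< n f ≡ ∑< n g
∑-cong zero    f≗g = refl
∑-cong (suc n) f≗g = cong₂ _+_ (f≗g 0) (∑-cong n (λ k → f≗g (suc k)))

∑-+ : ∀ (f g : ℕ → ℚ) n → ∑[ k < n ] (f k + g k) ≡ ∑< n f + ∑< n g
∑-+ f g zero    = refl
∑-+ f g (suc n) = begin
  (f 0 + g 0) + ∑[ k < n ] (f (suc k) + g (suc k))  ≡⟨ cong (_+_ (f 0 + g 0)) (∑-+ (λ k → f (suc k)) (λ k → g (suc k)) n) ⟩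
  (f 0 + g 0) + (F + G)                              ≡⟨ solve 4 (λ a b c d → (a :+ b) :+ (c :+ d) := (a :+ c) :+ (b :+ d)) refl (f 0) (g 0) F G ⟩
  (f 0 + F) + (g 0 + G)                              ∎
  where
  F = ∑[ k < n ] f (suc k)
  G = ∑[ k < n ] g (suc k)

*-distribˡ-∑ : ∀ c (f : ℕ → ℚ) n → ∑[ k < n ] (c * f k) ≡ c * ∑< n f
*-distribˡ-∑ c f zero    = sym (ℚP.*-zeroʳ c)
*-distribˡ-∑ c f (suc n) = trans (cong (_+_ (c * f 0)) (*-distribˡ-∑ c (λ k → f (suc k)) n))
                                 (sym (ℚP.*-distribˡ-+ c (f 0) _))

∑-suc : ∀ (f : ℕ → ℚ) n → ∑< (suc n) f ≡ ∑< n f + f n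
∑-suc f zero    = trans (ℚP.+-identityʳ (f 0)) (sym (ℚP.+-identityˡ (f 0)))
∑-suc f (suc n) = trans (cong (_+_ (f 0)) (∑-suc (λ k → f (suc k)) n)) (sym (ℚP.+-assoc (f 0) _ _))

term : ℕ → ℕ → ℚ → ℕ → ℚ
term r n x k = ((fromℕ (n C k) * sgn k) * pow x (n ∸ k)) * invBinom r k

S≡∑term : ∀ r n x → S r n x ≡ ∑< (suc n) (term r n x)
S≡∑term r n x = foldr-map-applyUpTo (term r n x) id (suc n)

term-zero : ∀ s m x → term s m x 0 ≡ pow x m
term-zero s m x = begin
  ((1ℚ * 1ℚ) * pow x m) * inv ((s ℕ.+ 0) C s)  ≡⟨ cong (λ u → ((1ℚ * 1ℚ) * pow x m) * inv (u C s)) (ℕP.+-identityʳ s) ⟩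
  ((1ℚ * 1ℚ) * pow x m) * inv (s C s)          ≡⟨ cong (λ u → ((1ℚ * 1ℚ) * pow x m) * inv u) (nCn≡1 s) ⟩
  ((1ℚ * 1ℚ) * pow x m) * 1ℚ                   ≡⟨ solve 1 (λ p → ((con 1ℚ :* con 1ℚ) :* p) :* con 1ℚ := p) refl (pow x m) ⟩
  pow x m                                      ∎

term-beyond : ∀ s m x → term s m x (suc m) ≡ 0ℚ
term-beyond s m x = begin
  ((fromℕ (m C suc m) * g) * P) * i  ≡⟨ cong (λ u → ((fromℕ u * g) * P) * i) (k>n⇒nCk≡0 (ℕP.n<1+n m)) ⟩
  ((0ℚ * g) * P) * i                 ≡⟨ solve 3 (λ g P i → ((con 0ℚ :* g) :* P) :* i := con 0ℚ) refl g P i ⟩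
  0ℚ                                 ∎
  where
  g = sgn (suc m)
  P = pow x (m ∸ suc m)
  i = invBinom s (suc m)

term-absorb : ∀ s m x k → fromℕ (suc m) * term (suc s) m x k ≡ (- fromℕ (suc s)) * term s (suc m) x (suc k)
term-absorb s m x k = begin
  fromℕ (suc m) * (((c * g) * P) * i)        ≡⟨ solve 5 (λ a c g p i → a :* (((c :* g) :* p) :* i) := (((a :* c) :* g) :* p) :* i) refl (fromℕ (suc m)) c g P i ⟩
  (((fromℕ (suc m) * c) * g) * P) * i        ≡⟨ cong (λ u → ((u * g) * P) * i) [1+m]*mCk≡[1+k]*[1+m]C[1+k] ⟩
  (((fromℕ (suc k) * c′) * g) * P) * i       ≡⟨ solve 5 (λ a c g p i → (((a :* c) :* g) :* p) :* i := ((c :* g) :* p) :* (a :* i)) refl (fromℕ (suc k)) c′ g P i ⟩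
  ((c′ * g) * P) * (fromℕ (suc k) * i)       ≡⟨ cong (((c′ * g) * P) *_) (invBinom-absorb s k) ⟩
  ((c′ * g) * P) * (fromℕ (suc s) * i′)      ≡⟨ solve 5 (λ a c g p i → ((c :* g) :* p) :* (a :* i) := (:- a) :* (((c :* (:- g)) :* p) :* i)) refl (fromℕ (suc s)) c′ g P i′ ⟩
  (- fromℕ (suc s)) * (((c′ * - g) * P) * i′) ∎
  where
  c = fromℕ (m C k)
  c′ = fromℕ (suc m C suc k)
  g = sgn k
  P = pow x (m ∸ k)
  i = invBinom (suc s) k
  i′ = invBinom s (suc k)
  [1+m]*mCk≡[1+k]*[1+m]C[1+k] : fromℕ (suc m) * c ≡ fromℕ (suc k) * c′
  [1+m]*mCk≡[1+k]*[1+m]C[1+k] = trans (sym (fromℕ-* (suc m) (m C k)))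
    (trans (cong fromℕ (sym ([1+k]*[1+n]C[1+k]≡[1+n]*nCk m k))) (fromℕ-* (suc k) (suc m C suc k)))

S-absorb : ∀ s m x → fromℕ (suc m) * S (suc s) m x ≡ fromℕ (suc s) * pow x (suc m) - fromℕ (suc s) * S s (suc m) x
S-absorb s m x = begin
  fromℕ (suc m) * S (suc s) m x
    ≡⟨ cong (fromℕ (suc m) *_) (S≡∑term (suc s) m x) ⟩
  fromℕ (suc m) * ∑< (suc m) (term (suc s) m x)
    ≡⟨ *-distribˡ-∑ (fromℕ (suc m)) (term (suc s) m x) (suc m) ⟨
  ∑[ k < suc m ] (fromℕ (suc m) * term (suc s) m x k)
    ≡⟨ ∑-cong (suc m) (term-absorb s m x) ⟩
  ∑[ k < suc m ] ((- a) * term s (suc m) x (suc k))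
    ≡⟨ *-distribˡ-∑ (- a) (λ k → term s (suc m) x (suc k)) (suc m) ⟩
  (- a) * R
    ≡⟨ solve 3 (λ a p r → (:- a) :* r := a :* p :- a :* (p :+ r)) refl a (pow x (suc m)) R ⟩
  a * pow x (suc m) - a * (pow x (suc m) + R)
    ≡⟨ cong (λ u → a * pow x (suc m) - a * (u + R)) (term-zero s (suc m) x) ⟨
  a * pow x (suc m) - a * ∑< (suc (suc m)) (term s (suc m) x)
    ≡⟨ cong (λ u → a * pow x (suc m) - a * u) (S≡∑term s (suc m) x) ⟨
  a * pow x (suc m) - a * S s (suc m) x ∎
  where
  a = fromℕ (suc s)
  R = ∑[ k < suc m ] term s (suc m) x (suc k)

-- The share of term s (m+1) x (k+1) that Pascal's rule C(m+1,k+1) = C(m,k) + C(m,k+1)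
-- attributes to C(m,k).
pascalTerm : ℕ → ℕ → ℚ → ℕ → ℚ
pascalTerm s m x k = ((fromℕ (m C k) * - sgn k) * pow x (m ∸ k)) * invBinom s (suc k)

term-pascal : ∀ s m x k → term s (suc m) x (suc k) ≡ pascalTerm s m x k + x * term s m x (suc k)
term-pascal s m x k = begin
  ((fromℕ (suc m C suc k) * - g) * P) * i
    ≡⟨ cong (λ u → ((u * - g) * P) * i) (trans (cong fromℕ (sym (nCk+nC[k+1]≡[n+1]C[k+1] m k))) (fromℕ-+ (m C k) (m C suc k))) ⟩
  (((fromℕ (m C k) + c) * - g) * P) * i
    ≡⟨ solve 5 (λ a c g P i → (((a :+ c) :* (:- g)) :* P) :* i := (((a :* (:- g)) :* P) :* i) :+ (((c :* (:- g)) :* P) :* i)) refl (fromℕ (m C k)) c g P i ⟩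
  pascalTerm s m x k + ((c * - g) * P) * i
    ≡⟨ cong (_+_ (pascalTerm s m x k)) extract-x ⟩
  pascalTerm s m x k + x * (((c * - g) * P′) * i) ∎
  where
  c = fromℕ (m C suc k)
  g = sgn k
  P = pow x (m ∸ k)
  P′ = pow x (m ∸ suc k)
  i = invBinom s (suc k)
  extract-x : ((c * - g) * P) * i ≡ x * (((c * - g) * P′) * i)
  extract-x with k ℕ.<? m
  ... | yes k<m = begin
    ((c * - g) * P) * i         ≡⟨ cong (λ u → ((c * - g) * pow x u) * i) (ℕP.+-∸-assoc 1 k<m) ⟩
    ((c * - g) * (x * P′)) * i  ≡⟨ solve 5 (λ c g x p i → ((c :* (:- g)) :* (x :* p)) :* i := x :* (((c :* (:- g)) :* p) :* i)) refl c g x P′ i ⟩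
    x * (((c * - g) * P′) * i)  ∎
  ... | no k≮m = begin
    ((c * - g) * P) * i            ≡⟨ cong (λ u → ((u * - g) * P) * i) c≡0 ⟩
    ((0ℚ * - g) * P) * i           ≡⟨ solve 5 (λ g P P′ i x → ((con 0ℚ :* (:- g)) :* P) :* i := x :* (((con 0ℚ :* (:- g)) :* P′) :* i)) refl g P P′ i x ⟩
    x * (((0ℚ * - g) * P′) * i)    ≡⟨ cong (λ u → x * (((u * - g) * P′) * i)) c≡0 ⟨
    x * (((c * - g) * P′) * i)     ∎
    where
    c≡0 : c ≡ 0ℚ
    c≡0 = cong fromℕ (k>n⇒nCk≡0 (s≤s (ℕP.≮⇒≥ k≮m)))

S-suc : ∀ s m x → S s (suc m) x ≡ x * S s m x + ∑< (suc m) (pascalTerm s m x)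
S-suc s m x = begin
  S s (suc m) x
    ≡⟨ S≡∑term s (suc m) x ⟩
  term s (suc m) x 0 + ∑[ k < suc m ] term s (suc m) x (suc k)
    ≡⟨ cong₂ _+_ (trans (term-zero s (suc m) x) (cong (x *_) (sym (term-zero s m x)))) (∑-cong (suc m) (term-pascal s m x)) ⟩
  x * T₀ + ∑[ k < suc m ] (pascalTerm s m x k + x * term s m x (suc k))
    ≡⟨ cong (_+_ (x * T₀)) (∑-+ (pascalTerm s m x) (λ k → x * term s m x (suc k)) (suc m)) ⟩
  x * T₀ + (Π + ∑[ k < suc m ] (x * term s m x (suc k)))
    ≡⟨ cong (λ u → x * T₀ + (Π + u)) (*-distribˡ-∑ x (λ k → term s m x (suc k)) (suc m)) ⟩
  x * T₀ + (Π + x * ∑[ k < suc m ] term s m x (suc k))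
    ≡⟨ cong (λ u → x * T₀ + (Π + x * u)) (∑-suc (λ k → term s m x (suc k)) m) ⟩
  x * T₀ + (Π + x * (R + term s m x (suc m)))
    ≡⟨ cong (λ u → x * T₀ + (Π + x * (R + u))) (term-beyond s m x) ⟩
  x * T₀ + (Π + x * (R + 0ℚ))
    ≡⟨ solve 4 (λ x a u r → x :* a :+ (u :+ x :* (r :+ con 0ℚ)) := x :* (a :+ r) :+ u) refl x T₀ Π R ⟩
  x * (T₀ + R) + Π
    ≡⟨ cong (λ u → x * u + Π) (S≡∑term s m x) ⟨
  x * S s m x + Π ∎
  where
  T₀ = term s m x 0
  Π = ∑< (suc m) (pascalTerm s m x)
  R = ∑[ k < m ] term s m x (suc k)

term-+-pascalTerm : ∀ s m x k → fromℕ (suc s) * (term s m x k + pascalTerm s m x k) ≡ fromℕ s * term (suc s) m x k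
term-+-pascalTerm s m x k = begin
  a * (((c * g) * P) * i + ((c * - g) * P) * i′)
    ≡⟨ solve 6 (λ a c g P i j → a :* (((c :* g) :* P) :* i :+ ((c :* (:- g)) :* P) :* j) := ((c :* g) :* P) :* (a :* i :- a :* j)) refl a c g P i i′ ⟩
  ((c * g) * P) * (a * i - a * i′)
    ≡⟨ cong (((c * g) * P) *_) (invBinom-pascal s k) ⟩
  ((c * g) * P) * (fromℕ s * invBinom (suc s) k)
    ≡⟨ solve 5 (λ c g P a z → ((c :* g) :* P) :* (a :* z) := a :* (((c :* g) :* P) :* z)) refl c g P (fromℕ s) (invBinom (suc s) k) ⟩
  fromℕ s * term (suc s) m x k ∎
  where
  a = fromℕ (suc s)
  c = fromℕ (m C k)
  g = sgn k
  P = pow x (m ∸ k)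
  i = invBinom s k
  i′ = invBinom s (suc k)

S-pascal : ∀ s m x → fromℕ s * S (suc s) m x ≡ fromℕ (suc s) * S s (suc m) x - fromℕ (suc s) * ((x - 1ℚ) * S s m x)
S-pascal s m x = sym (begin
  a * S s (suc m) x - a * ((x - 1ℚ) * S s m x)
    ≡⟨ cong (λ u → a * u - a * ((x - 1ℚ) * S s m x)) (S-suc s m x) ⟩
  a * (x * S s m x + Π) - a * ((x - 1ℚ) * S s m x)
    ≡⟨ solve 4 (λ a x f u → a :* (x :* f :+ u) :- a :* ((x :- con 1ℚ) :* f) := a :* (f :+ u)) refl a x (S s m x) Π ⟩
  a * (S s m x + Π)
    ≡⟨ cong (λ u → a * (u + Π)) (S≡∑term s m x) ⟩
  a * (∑< (suc m) (term s m x) + Π)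
    ≡⟨ cong (a *_) (∑-+ (term s m x) (pascalTerm s m x) (suc m)) ⟨
  a * ∑[ k < suc m ] (term s m x k + pascalTerm s m x k)
    ≡⟨ *-distribˡ-∑ a (λ k → term s m x k + pascalTerm s m x k) (suc m) ⟨
  ∑[ k < suc m ] (a * (term s m x k + pascalTerm s m x k))
    ≡⟨ ∑-cong (suc m) (term-+-pascalTerm s m x) ⟩
  ∑[ k < suc m ] (fromℕ s * term (suc s) m x k)
    ≡⟨ *-distribˡ-∑ (fromℕ s) (term (suc s) m x) (suc m) ⟩
  fromℕ s * ∑< (suc m) (term (suc s) m x)
    ≡⟨ cong (fromℕ s *_) (S≡∑term (suc s) m x) ⟨
  fromℕ s * S (suc s) m x ∎)
  where
  a = fromℕ (suc s)
  Π = ∑< (suc m) (pascalTerm s m x)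

S-zero : ∀ m x → S 0 m x ≡ pow (x - 1ℚ) m
S-zero zero    x = refl
S-zero (suc m) x = begin
  S 0 (suc m) x                                          ≡⟨ solve 3 (λ s a f → s := (con 1ℚ :* s :- con 1ℚ :* (a :* f)) :+ a :* f) refl (S 0 (suc m) x) a (S 0 m x) ⟩
  (1ℚ * S 0 (suc m) x - 1ℚ * (a * S 0 m x)) + a * S 0 m x ≡⟨ cong (_+ a * S 0 m x) (S-pascal 0 m x) ⟨
  0ℚ * S 1 m x + a * S 0 m x                             ≡⟨ cong (_+ a * S 0 m x) (ℚP.*-zeroˡ (S 1 m x)) ⟩
  0ℚ + a * S 0 m x                                       ≡⟨ ℚP.+-identityˡ (a * S 0 m x) ⟩
  a * S 0 m x                                            ≡⟨ cong (a *_) (S-zero m x) ⟩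
  a * pow a m                                            ∎
  where a = x - 1ℚ

IsInteger : ℚ → Set
IsInteger q = ∃ λ z → q ≡ fromℤ z

isInteger-+ : ∀ {p q} → IsInteger p → IsInteger q → IsInteger (p + q)
isInteger-+ (a , p≡a) (b , q≡b) = a ℤ.+ b , trans (cong₂ _+_ p≡a q≡b) (sym (fromℤ-+ a b))

isInteger-* : ∀ {p q} → IsInteger p → IsInteger q → IsInteger (p * q)
isInteger-* (a , p≡a) (b , q≡b) = a ℤ.* b , trans (cong₂ _*_ p≡a q≡b) (sym (fromℤ-* a b))

isInteger-neg : ∀ {p} → IsInteger p → IsInteger (- p)
isInteger-neg (a , p≡a) = ℤ.- a , trans (cong -_ p≡a) (sym (fromℤ-neg a))

isInteger-- : ∀ {p q} → IsInteger p → IsInteger q → IsInteger (p - q)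
isInteger-- p∈ℤ q∈ℤ = isInteger-+ p∈ℤ (isInteger-neg q∈ℤ)

isInteger-fromℕ : ∀ n → IsInteger (fromℕ n)
isInteger-fromℕ n = + n , refl

isInteger-pow : ∀ {p} k → IsInteger p → IsInteger (pow p k)
isInteger-pow zero    p∈ℤ = ℤ.1ℤ , refl
isInteger-pow (suc k) p∈ℤ = isInteger-* p∈ℤ (isInteger-pow k p∈ℤ)

rising : ℕ → ℕ → ℕ
rising m zero    = 1
rising m (suc c) = m ℕ.* rising (suc m) c

m!*rising[1+m]c≡[m+c]! : ∀ m c → m ! ℕ.* rising (suc m) c ≡ (m ℕ.+ c) !
m!*rising[1+m]c≡[m+c]! m zero = trans (ℕP.*-identityʳ (m !)) (cong _! (sym (ℕP.+-identityʳ m)))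
m!*rising[1+m]c≡[m+c]! m (suc c) = begin
  m ! ℕ.* (suc m ℕ.* rising (suc (suc m)) c)  ≡⟨ ℕP.*-assoc (m !) (suc m) _ ⟨
  (m ! ℕ.* suc m) ℕ.* rising (suc (suc m)) c  ≡⟨ cong (ℕ._* rising (suc (suc m)) c) (ℕP.*-comm (m !) (suc m)) ⟩
  suc m ! ℕ.* rising (suc (suc m)) c          ≡⟨ m!*rising[1+m]c≡[m+c]! (suc m) c ⟩
  (suc m ℕ.+ c) !                             ≡⟨ cong _! (ℕP.+-suc m c) ⟨
  (m ℕ.+ suc c) !                             ∎

rising2≡[1+c]! : ∀ c → rising 2 c ≡ suc c !
rising2≡[1+c]! c = trans (sym (trans (ℕP.*-identityˡ (1 ℕ.* rising 2 c)) (ℕP.*-identityˡ (rising 2 c))))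
                          (m!*rising[1+m]c≡[m+c]! 0 (suc c))

scaledS : ℚ → ℕ → ℕ → ℕ → ℕ → ℚ
scaledS x n r′ k j = fromℕ (rising (suc r′) (k ℕ.+ j)) * (pow (x - 1ℚ) k * S r′ (n ℕ.+ j) x)

module _ {x : ℚ} (x∈ℤ : IsInteger x) (r n : ℕ) (S∈ℤ : IsInteger (S r n x)) where

  scaledS₀-isInteger : ∀ j r′ → r′ ℕ.+ j ≡ r → IsInteger (scaledS x n r′ 0 j)
  scaledS₀-isInteger zero r′ r′+0≡r = subst IsInteger (sym (begin
    1ℚ * (1ℚ * S r′ (n ℕ.+ 0) x)  ≡⟨ solve 1 (λ s → con 1ℚ :* (con 1ℚ :* s) := s) refl (S r′ (n ℕ.+ 0) x) ⟩
    S r′ (n ℕ.+ 0) x              ≡⟨ cong₂ (λ u v → S u v x) (trans (sym (ℕP.+-identityʳ r′)) r′+0≡r) (ℕP.+-identityʳ n) ⟩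
    S r n x                       ∎)) S∈ℤ
  scaledS₀-isInteger (suc j) r′ r′+1+j≡r = subst IsInteger (sym eq)
    (isInteger-- (isInteger-* (isInteger-fromℕ q) (isInteger-* (isInteger-fromℕ (suc r′)) (isInteger-pow (suc (n ℕ.+ j)) x∈ℤ)))
                 (isInteger-* (isInteger-fromℕ (suc (n ℕ.+ j))) next))
    where
    q = rising (suc (suc r′)) j
    G = S (suc r′) (n ℕ.+ j) x
    b = fromℕ (suc r′)
    X = pow x (suc (n ℕ.+ j))
    next : IsInteger (scaledS x n (suc r′) 0 j)
    next = scaledS₀-isInteger j (suc r′) (trans (sym (ℕP.+-suc r′ j)) r′+1+j≡r)
    eq : scaledS x n r′ 0 (suc j) ≡ fromℕ q * (b * X) - fromℕ (suc (n ℕ.+ j)) * scaledS x n (suc r′) 0 j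
    eq = begin
      fromℕ (suc r′ ℕ.* q) * (1ℚ * S r′ (n ℕ.+ suc j) x)
        ≡⟨ cong₂ (λ u v → u * (1ℚ * S r′ v x)) (fromℕ-* (suc r′) q) (ℕP.+-suc n j) ⟩
      (b * fromℕ q) * (1ℚ * S r′ (suc (n ℕ.+ j)) x)
        ≡⟨ solve 5 (λ b q f p g → (b :* q) :* (con 1ℚ :* f) := q :* (b :* p) :- q :* (b :* p :- b :* f)) refl b (fromℕ q) (S r′ (suc (n ℕ.+ j)) x) X G ⟩
      fromℕ q * (b * X) - fromℕ q * (b * X - b * S r′ (suc (n ℕ.+ j)) x)
        ≡⟨ cong (λ u → fromℕ q * (b * X) - fromℕ q * u) (S-absorb r′ (n ℕ.+ j) x) ⟨
      fromℕ q * (b * X) - fromℕ q * (fromℕ (suc (n ℕ.+ j)) * G)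
        ≡⟨ solve 4 (λ A q m g → A :- q :* (m :* g) := A :- m :* (q :* (con 1ℚ :* g))) refl (fromℕ q * (b * X)) (fromℕ q) (fromℕ (suc (n ℕ.+ j))) G ⟩
      fromℕ q * (b * X) - fromℕ (suc (n ℕ.+ j)) * scaledS x n (suc r′) 0 j ∎

  scaledS-isInteger : ∀ k j r′ → r′ ℕ.+ (k ℕ.+ j) ≡ r → IsInteger (scaledS x n r′ k j)
  scaledS-isInteger zero    j r′ r′+j≡r = scaledS₀-isInteger j r′ r′+j≡r
  scaledS-isInteger (suc k) j r′ r′+1+k+j≡r = subst IsInteger (sym eq)
    (isInteger-- (scaledS-isInteger k (suc j) r′ (trans (cong (r′ ℕ.+_) (ℕP.+-suc k j)) r′+1+k+j≡r))
                 (isInteger-* (isInteger-fromℕ r′) (scaledS-isInteger k j (suc r′) (trans (sym (ℕP.+-suc r′ (k ℕ.+ j))) r′+1+k+j≡r))))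
    where
    a = x - 1ℚ
    b = fromℕ (suc r′)
    q = fromℕ (rising (suc (suc r′)) (k ℕ.+ j))
    K = pow a k
    f = S r′ (n ℕ.+ j) x
    G = S (suc r′) (n ℕ.+ j) x
    H = S r′ (n ℕ.+ suc j) x
    pascal : fromℕ r′ * G ≡ b * H - b * (a * f)
    pascal = trans (S-pascal r′ (n ℕ.+ j) x) (cong (λ u → b * S r′ u x - b * (a * f)) (sym (ℕP.+-suc n j)))
    eq : scaledS x n r′ (suc k) j ≡ scaledS x n r′ k (suc j) - fromℕ r′ * scaledS x n (suc r′) k j
    eq = begin
      fromℕ (suc r′ ℕ.* rising (suc (suc r′)) (k ℕ.+ j)) * ((a * K) * f)
        ≡⟨ cong (_* ((a * K) * f)) (fromℕ-* (suc r′) (rising (suc (suc r′)) (k ℕ.+ j))) ⟩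
      (b * q) * ((a * K) * f)
        ≡⟨ solve 6 (λ b q a K f h → (b :* q) :* ((a :* K) :* f) := (b :* q) :* (K :* h) :- (q :* K) :* (b :* h :- b :* (a :* f))) refl b q a K f H ⟩
      (b * q) * (K * H) - (q * K) * (b * H - b * (a * f))
        ≡⟨ cong (λ u → (b * q) * (K * H) - (q * K) * u) pascal ⟨
      (b * q) * (K * H) - (q * K) * (fromℕ r′ * G)
        ≡⟨ cong₂ (λ u v → u * (K * H) - v)
             (trans (sym (fromℕ-* (suc r′) (rising (suc (suc r′)) (k ℕ.+ j)))) (cong (λ u → fromℕ (rising (suc r′) u)) (sym (ℕP.+-suc k j))))
             (solve 4 (λ q K ρ g → (q :* K) :* (ρ :* g) := ρ :* (q :* (K :* g))) refl q K (fromℕ r′) G) ⟩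
      scaledS x n r′ k (suc j) - fromℕ r′ * scaledS x n (suc r′) k j ∎

S-one : ∀ m x → fromℕ (suc m) * S 1 m x ≡ pow x (suc m) - pow (x - 1ℚ) (suc m)
S-one m x = begin
  fromℕ (suc m) * S 1 m x                       ≡⟨ S-absorb 0 m x ⟩
  1ℚ * pow x (suc m) - 1ℚ * S 0 (suc m) x       ≡⟨ cong (λ u → 1ℚ * pow x (suc m) - 1ℚ * u) (S-zero (suc m) x) ⟩
  1ℚ * pow x (suc m) - 1ℚ * pow (x - 1ℚ) (suc m) ≡⟨ solve 2 (λ p q → con 1ℚ :* p :- con 1ℚ :* q := p :- q) refl (pow x (suc m)) (pow (x - 1ℚ) (suc m)) ⟩
  pow x (suc m) - pow (x - 1ℚ) (suc m)          ∎

obstruction : ℕ → ℕ → ℕ → ℤ → ℤ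
obstruction n r d ℓ = (+ (r !) ℤ.* ((ℓ ℤ.- ℤ.1ℤ) ℤ.^ (r ∸ d))) ℤ.* (((ℓ ℤ.- ℤ.1ℤ) ℤ.^ (n ℕ.+ d)) ℤ.- (ℓ ℤ.^ (n ℕ.+ d)))

fromℤ-obstruction : ∀ n r d ℓ → let x = fromℤ ℓ in
  fromℤ (obstruction n r d ℓ) ≡ (fromℕ (r !) * pow (x - 1ℚ) (r ∸ d)) * (pow (x - 1ℚ) (n ℕ.+ d) - pow x (n ℕ.+ d))
fromℤ-obstruction n r d ℓ = begin
  fromℤ ((+ (r !) ℤ.* (ℓ-1 ℤ.^ (r ∸ d))) ℤ.* ((ℓ-1 ℤ.^ N) ℤ.- (ℓ ℤ.^ N)))
    ≡⟨ fromℤ-* (+ (r !) ℤ.* (ℓ-1 ℤ.^ (r ∸ d))) ((ℓ-1 ℤ.^ N) ℤ.- (ℓ ℤ.^ N)) ⟩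
  fromℤ (+ (r !) ℤ.* (ℓ-1 ℤ.^ (r ∸ d))) * fromℤ ((ℓ-1 ℤ.^ N) ℤ.- (ℓ ℤ.^ N))
    ≡⟨ cong₂ _*_ (fromℤ-* (+ (r !)) (ℓ-1 ℤ.^ (r ∸ d))) (fromℤ-- (ℓ-1 ℤ.^ N) (ℓ ℤ.^ N)) ⟩
  (fromℕ (r !) * fromℤ (ℓ-1 ℤ.^ (r ∸ d))) * (fromℤ (ℓ-1 ℤ.^ N) - fromℤ (ℓ ℤ.^ N))
    ≡⟨ cong₂ (λ u v → (fromℕ (r !) * u) * v) (fromℤ-[ℓ-1]^ (r ∸ d))
         (cong₂ _-_ (fromℤ-[ℓ-1]^ N) (fromℤ-pow ℓ N)) ⟩
  (fromℕ (r !) * pow (x - 1ℚ) (r ∸ d)) * (pow (x - 1ℚ) N - pow x N) ∎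
  where
  x = fromℤ ℓ
  ℓ-1 = ℓ ℤ.- ℤ.1ℤ
  N = n ℕ.+ d
  fromℤ-[ℓ-1]^ : ∀ k → fromℤ (ℓ-1 ℤ.^ k) ≡ pow (x - 1ℚ) k
  fromℤ-[ℓ-1]^ k = trans (fromℤ-pow ℓ-1 k) (cong (λ y → pow y k) (fromℤ-- ℓ ℤ.1ℤ))

n∣n*m : ∀ n m → + n ∣ + n ℤ.* m
n∣n*m n m = subst (n ℕD.∣_) (sym (ℤP.abs-* (+ n) m)) (ℕD.m∣m*n ℤ.∣ m ∣)

isInteger-S⇒n+d∣obstruction : ∀ n r d ℓ → suc d ≤ r → IsInteger (S r n (fromℤ ℓ)) →
  + (n ℕ.+ suc d) ∣ obstruction n r (suc d) ℓ
isInteger-S⇒n+d∣obstruction n r d ℓ d<r S∈ℤ = subst (+ N ∣_) (sym obstruction≡N*[-w]) (n∣n*m N (ℤ.- w))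
  where
  x = fromℤ ℓ
  a = x - 1ℚ
  k = r ∸ suc d
  N = n ℕ.+ suc d
  r≡1+[k+d] : 1 ℕ.+ (k ℕ.+ d) ≡ r
  r≡1+[k+d] = trans (sym (ℕP.+-suc k d)) (trans (ℕP.+-comm k (suc d)) (ℕP.m+[n∸m]≡n d<r))
  w-spec = scaledS-isInteger (ℓ , refl) r n S∈ℤ k d 1 r≡1+[k+d]
  w = proj₁ w-spec
  R = fromℕ (r !)
  A = pow a k
  S₁ = S 1 (n ℕ.+ d) x
  N*S₁≡xᴺ-aᴺ : fromℕ N * S₁ ≡ pow x N - pow a N
  N*S₁≡xᴺ-aᴺ = subst (λ M → fromℕ M * S₁ ≡ pow x M - pow a M) (sym (ℕP.+-suc n d)) (S-one (n ℕ.+ d) x)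
  R*A*S₁≡w : R * (A * S₁) ≡ fromℤ w
  R*A*S₁≡w = trans (cong (λ u → fromℕ u * (A * S₁)) (trans (cong _! (sym r≡1+[k+d])) (sym (rising2≡[1+c]! (k ℕ.+ d)))))
                   (proj₂ w-spec)
  obstruction≡N*[-w] : obstruction n r (suc d) ℓ ≡ + N ℤ.* ℤ.- w
  obstruction≡N*[-w] = fromℤ-injective _ _ (begin
    fromℤ (obstruction n r (suc d) ℓ)  ≡⟨ fromℤ-obstruction n r (suc d) ℓ ⟩
    (R * A) * (pow a N - pow x N)      ≡⟨ solve 4 (λ R A p q → (R :* A) :* (q :- p) := :- ((R :* A) :* (p :- q))) refl R A (pow x N) (pow a N) ⟩
    - ((R * A) * (pow x N - pow a N))  ≡⟨ cong (λ u → - ((R * A) * u)) N*S₁≡xᴺ-aᴺ ⟨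
    - ((R * A) * (fromℕ N * S₁))       ≡⟨ solve 4 (λ R A n s → :- ((R :* A) :* (n :* s)) := n :* (:- (R :* (A :* s)))) refl R A (fromℕ N) S₁ ⟩
    fromℕ N * - (R * (A * S₁))         ≡⟨ cong (λ u → fromℕ N * - u) R*A*S₁≡w ⟩
    fromℕ N * - fromℤ w                ≡⟨ cong (fromℕ N *_) (fromℤ-neg w) ⟨
    fromℕ N * fromℤ (ℤ.- w)            ≡⟨ fromℤ-* (+ N) (ℤ.- w) ⟨
    fromℤ (+ N ℤ.* ℤ.- w)              ∎)

proposition3p2 : (n r : ℕ) → 1 ≤ n → 1 ≤ r → (ℓ : ℤ) → ¬ ℓ ≡ ℤ.0ℤ → ¬ ℓ ≡ ℤ.1ℤ →
    (∃ λ (d : ℕ) → 1 ≤ d × d ≤ r ×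
      ¬ (+ (n ℕ.+ d) ∣ ((+ (r !) ℤ.* ((ℓ ℤ.- ℤ.1ℤ) ℤ.^ (r ℕ.∸ d))) ℤ.* (((ℓ ℤ.- ℤ.1ℤ) ℤ.^ (n ℕ.+ d)) ℤ.- (ℓ ℤ.^ (n ℕ.+ d)))))) →
    ¬ (∃ λ (z : ℤ) → S r n (fromℤ ℓ) ≡ fromℤ z)
proposition3p2 n r _ _ ℓ _ _ (suc d , _ , d<r , n+d∤obstruction) S∈ℤ =
  n+d∤obstruction (isInteger-S⇒n+d∣obstruction n r d ℓ d<r S∈ℤ)
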